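{- Let $m,i$ be positive integers. For integers $n\ge 0$ and $k\ge 0$ put $$A_{n,k}^{(m,i)}=\sum_{j=0}^{n}(-1)^{j}\binom{n}{j}\frac{1}{(mj+i)^{k}},$$ and define numbers $B_{n,k}^{(m,i)}$ ($n,k\ge 0$) recursively by $B_{n,0}^{(m,i)}=1$ for all $n\ge 0$ and $$B_{n,k}^{(m,i)}=\sum_{j=0}^{n}\frac{1}{mj+i}\,B_{j,k-1}^{(m,i)}\qquad (n\ge 0,\ k\ge 1).$$ Then $A_{0,0}^{(m,i)}=1$, $A_{n,0}^{(m,i)}=0$ for $n\ge 1$, $A_{n,1}^{(m,i)}=\dfrac{n!}{m\,(i/m)_{n+1}}$ for all $n\ge 0$, and for all $n\ge 0$, $k\ge 1$, $$A_{n,k}^{(m,i)}=\frac{n!}{m\,(i/m)_{n+1}}\,B_{n,k-1}^{(m,i)}.$$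
   Context: $(a)_n=a(a+1)\cdots(a+n-1)$ denotes the rising factorial, with $(a)_0=1$. -}

module Defs where

open import Data.Nat as ℕ using (ℕ; zero; suc; NonZero)
import Data.Nat.Properties as NP
open import Data.Nat.Combinatorics using (_C_)
open import Data.Integer as ℤ using (ℤ; +_)
open import Data.Rational as ℚ using (ℚ; 0ℚ; 1ℚ; _/_; _+_; _*_; _-_; -_; Positive; _÷_)
open import Data.Rational.Properties using (pos*pos⇒pos; pos+nonNeg⇒pos; pos⇒nonZero; normalize-pos)

Σ≤ : ℕ → (ℕ → ℚ) → ℚ
Σ≤ zero f = f 0
Σ≤ (suc n) f = Σ≤ n f + f (suc n)

sgn : ℕ → ℚ
sgn zero = 1ℚ
sgn (suc j) = - sgn j

_^ℚ_ : ℚ → ℕ → ℚ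
x ^ℚ zero = 1ℚ
x ^ℚ suc k = x * (x ^ℚ k)

ℕ→ℚ : ℕ → ℚ
ℕ→ℚ n = (+ n) / 1

poch : ℚ → ℕ → ℚ
poch a zero = 1ℚ
poch a (suc n) = poch a n * (a + ℕ→ℚ n)

lin : ℕ → ℕ → ℕ → ℕ
lin m i j = m ℕ.* j ℕ.+ i

lin-nonZero : ∀ {m i j} .{{_ : NonZero i}} → NonZero (lin m i j)
lin-nonZero {m} {suc i} {j} rewrite NP.+-comm (m ℕ.* j) (suc i) = _

inv-pow : (m i j k : ℕ) → .{{NonZero i}} → ℚ
inv-pow m i j k = (((+ 1) / lin m i j) {{lin-nonZero {m} {i} {j}}}) ^ℚ k

A : (m i : ℕ) → .{{NonZero i}} → ℕ → ℕ → ℚ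
A m i n k = Σ≤ n (λ j → sgn j * ℕ→ℚ (n C j) * inv-pow m i j k)

B : (m i : ℕ) → .{{NonZero i}} → ℕ → ℕ → ℚ
B m i n zero = 1ℚ
B m i n (suc k) = Σ≤ n (λ j → ((+ 1) / lin m i j) {{lin-nonZero {m} {i} {j}}} * B m i j k)

ratio : (i m : ℕ) → .{{NonZero m}} → ℚ
ratio i m = (+ i) / m

private
  import Data.Rational.Properties as QP

  nat-nonNeg : ∀ n → ℚ.NonNegative (ℕ→ℚ n)
  nat-nonNeg zero = _
  nat-nonNeg (suc n) = QP.pos⇒nonNeg (ℕ→ℚ (suc n)) {{normalize-pos (suc n) 1}}

  poch-pos : ∀ a .{{_ : Positive a}} n → Positive (poch a n)
  poch-pos a zero = _
  poch-pos a (suc n) =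
    pos*pos⇒pos (poch a n) {{poch-pos a n}} (a + ℕ→ℚ n)
      {{pos+nonNeg⇒pos a (ℕ→ℚ n) {{nat-nonNeg n}}}}

  denom-pos : ∀ m i .{{_ : NonZero m}} .{{_ : NonZero i}} n →
              Positive (ℕ→ℚ m * poch (ratio i m) n)
  denom-pos (suc m) (suc i) n =
    pos*pos⇒pos (ℕ→ℚ (suc m)) {{normalize-pos (suc m) 1}} (poch (ratio (suc i) (suc m)) n)
      {{poch-pos (ratio (suc i) (suc m)) {{normalize-pos (suc i) (suc m)}} n}}

coeff : (m i : ℕ) → .{{NonZero m}} → .{{NonZero i}} → ℕ → ℚ
coeff m i n = (ℕ→ℚ (n ℕ.!) ÷ (ℕ→ℚ m * poch (ratio i m) (suc n)))
                {{pos⇒nonZero (ℕ→ℚ m * poch (ratio i m) (suc n)) {{denom-pos m i (suc n)}}}}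

module Submission where

-- Write L_j = m j + i, so that 1 / (m j + i) is the j-th "reciprocal" a_j.
-- The proof rests on three recurrences, all checked term by term:
--   (1) Pascal-type recurrence for A: from the binomial identity
--         L_{n+1} C(n+1,j) = L_j C(n+1,j) + (n+1) m C(n,j)
--       one gets  L_{n+1} A_{n+1,k+1} = A_{n+1,k} + (n+1) m A_{n,k+1};
--   (2) the coefficient c_n = n! / (m (i/m)_{n+1}) satisfies c_0 = a_0 and
--         L_{n+1} c_{n+1} = (n+1) m c_n,  since m (i/m + n + 1) = L_{n+1};
--   (3) B satisfies B_{n+1,k+1} = B_{n,k+1} + a_{n+1} B_{n+1,k} by definition.
-- The values A_{n,0} follow from telescoping alternating sums of a row of
-- Pascal's triangle.  The identity A_{n,k+1} = c_n B_{n,k} is then proved by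
-- induction on k and n: at n = 0 both sides equal a_0^{k+1}, and for n + 1
-- both sides satisfy the same recurrence after multiplication by L_{n+1},
-- which is cancelled using its inverse a_{n+1}.

open import Defs
open import Data.Nat as Nat using (ℕ; zero; suc; NonZero; _!)
import Data.Nat.Properties as NP
open import Data.Nat.Combinatorics using (_C_; k>n⇒nCk≡0; nC1≡n; nCk+nC[k+1]≡[n+1]C[k+1])
open import Data.Nat.Solver renaming (module +-*-Solver to ℕ-Solver)
open import Data.Integer using (+_)
open import Data.Integer.Solver renaming (module +-*-Solver to ℤ-Solver)
open import Data.Rational as ℚ using (ℚ; 0ℚ; 1ℚ; _/_; 1/_; toℚᵘ; Positive)
import Data.Rational.Properties as QP
open import Data.Rational.Solver renaming (module +-*-Solver to ℚ-Solver)
open import Data.Rational.Unnormalised as U using (mkℚᵘ; *≡*)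
import Data.Rational.Unnormalised.Properties as UP
open import Data.Product using (_×_; _,_)
open import Relation.Binary.PropositionalEquality

module BinomialIdentities where
  open Nat using (_+_; _*_)
  open ≡-Reasoning

  pascal : ∀ n k → suc n C suc k ≡ n C k + n C suc k
  pascal n k = sym (nCk+nC[k+1]≡[n+1]C[k+1] n k)

  row-end : ∀ n → n C suc n ≡ 0
  row-end n = k>n⇒nCk≡0 (NP.n<1+n n)

  absorption : ∀ n k → suc k * (suc n C suc k) ≡ suc n * (n C k)
  absorption n zero =
    trans (NP.*-identityˡ (suc n C 1)) (trans (nC1≡n (suc n)) (sym (NP.*-identityʳ (suc n))))
  absorption zero (suc k) =
    trans (cong (suc (suc k) *_) (k>n⇒nCk≡0 {1} {suc (suc k)} (Nat.s≤s (Nat.s≤s Nat.z≤n))))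
          (trans (NP.*-zeroʳ (suc (suc k))) (cong (1 *_) (sym (k>n⇒nCk≡0 {0} {suc k} (Nat.s≤s Nat.z≤n)))))
  absorption (suc n) (suc k) = begin
    (2 + k) * ((2 + n) C (2 + k))          ≡⟨ cong ((2 + k) *_) (pascal (suc n) (suc k)) ⟩
    (2 + k) * (X + Y)                      ≡⟨ solve 3 (λ k X Y → (con 2 :+ k) :* (X :+ Y) := ((con 1 :+ k) :* X :+ X) :+ (con 2 :+ k) :* Y) refl k X Y ⟩
    ((1 + k) * X + X) + (2 + k) * Y        ≡⟨ cong₂ (λ u v → (u + X) + v) (absorption n k) (absorption n (suc k)) ⟩
    ((1 + n) * a + X) + (1 + n) * b        ≡⟨ cong (λ t → ((1 + n) * a + t) + (1 + n) * b) (pascal n k) ⟩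
    ((1 + n) * a + (a + b)) + (1 + n) * b  ≡⟨ solve 3 (λ n a b → ((con 1 :+ n) :* a :+ (a :+ b)) :+ (con 1 :+ n) :* b := (con 2 :+ n) :* (a :+ b)) refl n a b ⟩
    (2 + n) * (a + b)                      ≡⟨ cong ((2 + n) *_) (sym (pascal n k)) ⟩
    (2 + n) * ((1 + n) C (1 + k))          ∎
    where
    open ℕ-Solver
    X = suc n C suc k
    Y = suc n C suc (suc k)
    a = n C k
    b = n C suc k

  -- Equivalently (n+1-j) C(n+1,j) = (n+1) C(n,j), written without subtraction.
  binomial-split : ∀ n j → j * (suc n C j) + suc n * (n C j) ≡ suc n * (suc n C j)
  binomial-split n zero = refl
  binomial-split n (suc j) = begin
    suc j * (suc n C suc j) + suc n * (n C suc j)  ≡⟨ cong (_+ suc n * (n C suc j)) (absorption n j) ⟩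
    suc n * (n C j) + suc n * (n C suc j)          ≡⟨ sym (NP.*-distribˡ-+ (suc n) (n C j) (n C suc j)) ⟩
    suc n * (n C j + n C suc j)                    ≡⟨ cong (suc n *_) (sym (pascal n j)) ⟩
    suc n * (suc n C suc j)                        ∎

  lin-binomial : ∀ m i n j →
    lin m i (suc n) * (suc n C j) ≡ lin m i j * (suc n C j) + (suc n * m) * (n C j)
  lin-binomial m i n j = begin
    lin m i (suc n) * c′               ≡⟨ solve 4 (λ m i n c′ → (m :* (con 1 :+ n) :+ i) :* c′ := m :* ((con 1 :+ n) :* c′) :+ i :* c′) refl m i n c′ ⟩
    m * (suc n * c′) + i * c′          ≡⟨ cong (λ t → m * t + i * c′) (sym (binomial-split n j)) ⟩
    m * (j * c′ + suc n * c) + i * c′  ≡⟨ solve 6 (λ m i n j c c′ → m :* (j :* c′ :+ (con 1 :+ n) :* c) :+ i :* c′ := (m :* j :+ i) :* c′ :+ ((con 1 :+ n) :* m) :* c) refl m i n j c c′ ⟩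
    lin m i j * c′ + (suc n * m) * c   ∎
    where
    open ℕ-Solver
    c′ = suc n C j
    c = n C j

open BinomialIdentities

open import Data.Rational using (_+_; _*_)

-- Unnormalised representatives of n and a / n; identities between casts are
-- checked in ℚᵘ, where they reduce to integer ring identities.
toℚᵘ-ℕ→ℚ : ∀ n → toℚᵘ (ℕ→ℚ n) U.≃ mkℚᵘ (+ n) 0
toℚᵘ-ℕ→ℚ n = QP.toℚᵘ-fromℚᵘ (mkℚᵘ (+ n) 0)

toℚᵘ-/ : ∀ a n .{{_ : NonZero n}} → toℚᵘ ((+ a) / n) U.≃ mkℚᵘ (+ a) (Nat.pred n)
toℚᵘ-/ a (suc n) = QP.toℚᵘ-fromℚᵘ (mkℚᵘ (+ a) n)

ℕ→ℚ-suc : ∀ n → ℕ→ℚ (suc n) ≡ 1ℚ + ℕ→ℚ n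
ℕ→ℚ-suc n = QP.toℚᵘ-injective (begin
  toℚᵘ (ℕ→ℚ (suc n))              ≈⟨ toℚᵘ-ℕ→ℚ (suc n) ⟩
  mkℚᵘ (+ suc n) 0                 ≈⟨ *≡* (solve 1 (λ x → (con (+ 1) :+ x) :* con (+ 1) := (con (+ 1) :* con (+ 1) :+ x :* con (+ 1)) :* con (+ 1)) refl (+ n)) ⟩
  mkℚᵘ (+ 1) 0 U.+ mkℚᵘ (+ n) 0    ≈⟨ UP.+-cong UP.≃-refl (UP.≃-sym (toℚᵘ-ℕ→ℚ n)) ⟩
  toℚᵘ 1ℚ U.+ toℚᵘ (ℕ→ℚ n)         ≈⟨ UP.≃-sym (QP.toℚᵘ-homo-+ 1ℚ (ℕ→ℚ n)) ⟩
  toℚᵘ (1ℚ + ℕ→ℚ n)               ∎)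
  where
  open UP.≃-Reasoning
  open ℤ-Solver

n*[a/n]≡a : ∀ n a .{{_ : NonZero n}} → ℕ→ℚ n * ((+ a) / n) ≡ ℕ→ℚ a
n*[a/n]≡a (suc k) a = QP.toℚᵘ-injective (begin
  toℚᵘ (ℕ→ℚ (suc k) * ((+ a) / suc k))          ≈⟨ QP.toℚᵘ-homo-* (ℕ→ℚ (suc k)) ((+ a) / suc k) ⟩
  toℚᵘ (ℕ→ℚ (suc k)) U.* toℚᵘ ((+ a) / suc k)   ≈⟨ UP.*-cong (toℚᵘ-ℕ→ℚ (suc k)) (toℚᵘ-/ a (suc k)) ⟩
  mkℚᵘ (+ suc k) 0 U.* mkℚᵘ (+ a) k             ≈⟨ *≡* (solve 2 (λ x y → ((con (+ 1) :+ y) :* x) :* con (+ 1) := x :* (con (+ 1) :* (con (+ 1) :+ y))) refl (+ a) (+ k)) ⟩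
  mkℚᵘ (+ a) 0                                   ≈⟨ UP.≃-sym (toℚᵘ-ℕ→ℚ a) ⟩
  toℚᵘ (ℕ→ℚ a)                                   ∎)
  where
  open UP.≃-Reasoning
  open ℤ-Solver

open ≡-Reasoning

ℕ→ℚ-+ : ∀ a b → ℕ→ℚ (a Nat.+ b) ≡ ℕ→ℚ a + ℕ→ℚ b
ℕ→ℚ-+ zero b = sym (QP.+-identityˡ (ℕ→ℚ b))
ℕ→ℚ-+ (suc a) b = begin
  ℕ→ℚ (suc (a Nat.+ b))  ≡⟨ ℕ→ℚ-suc (a Nat.+ b) ⟩
  1ℚ + ℕ→ℚ (a Nat.+ b)   ≡⟨ cong (λ t → 1ℚ + t) (ℕ→ℚ-+ a b) ⟩
  1ℚ + (ℕ→ℚ a + ℕ→ℚ b)   ≡⟨ sym (QP.+-assoc 1ℚ (ℕ→ℚ a) (ℕ→ℚ b)) ⟩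
  (1ℚ + ℕ→ℚ a) + ℕ→ℚ b   ≡⟨ cong (_+ ℕ→ℚ b) (sym (ℕ→ℚ-suc a)) ⟩
  ℕ→ℚ (suc a) + ℕ→ℚ b    ∎

ℕ→ℚ-* : ∀ a b → ℕ→ℚ (a Nat.* b) ≡ ℕ→ℚ a * ℕ→ℚ b
ℕ→ℚ-* zero b = sym (QP.*-zeroˡ (ℕ→ℚ b))
ℕ→ℚ-* (suc a) b = begin
  ℕ→ℚ (b Nat.+ a Nat.* b)  ≡⟨ ℕ→ℚ-+ b (a Nat.* b) ⟩
  ℕ→ℚ b + ℕ→ℚ (a Nat.* b)  ≡⟨ cong (λ t → ℕ→ℚ b + t) (ℕ→ℚ-* a b) ⟩
  ℕ→ℚ b + ℕ→ℚ a * ℕ→ℚ b    ≡⟨ solve 2 (λ a b → b :+ a :* b := (con 1ℚ :+ a) :* b) refl (ℕ→ℚ a) (ℕ→ℚ b) ⟩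
  (1ℚ + ℕ→ℚ a) * ℕ→ℚ b     ≡⟨ cong (_* ℕ→ℚ b) (sym (ℕ→ℚ-suc a)) ⟩
  ℕ→ℚ (suc a) * ℕ→ℚ b      ∎
  where open ℚ-Solver

cancel-invertible : ∀ {u r x y : ℚ} → u * r ≡ 1ℚ → r * x ≡ r * y → x ≡ y
cancel-invertible {u} {r} {x} {y} ur≡1 rx≡ry = begin
  x            ≡⟨ sym (QP.*-identityˡ x) ⟩
  1ℚ * x       ≡⟨ cong (_* x) (sym ur≡1) ⟩
  (u * r) * x  ≡⟨ QP.*-assoc u r x ⟩
  u * (r * x)  ≡⟨ cong (u *_) rx≡ry ⟩
  u * (r * y)  ≡⟨ sym (QP.*-assoc u r y) ⟩
  (u * r) * y  ≡⟨ cong (_* y) ur≡1 ⟩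
  1ℚ * y       ≡⟨ QP.*-identityˡ y ⟩
  y            ∎

Σ≤-cong : ∀ r {f g : ℕ → ℚ} → (∀ j → f j ≡ g j) → Σ≤ r f ≡ Σ≤ r g
Σ≤-cong zero f≡g = f≡g 0
Σ≤-cong (suc r) f≡g = cong₂ _+_ (Σ≤-cong r f≡g) (f≡g (suc r))

Σ≤-+ : ∀ r (f g : ℕ → ℚ) → Σ≤ r (λ j → f j + g j) ≡ Σ≤ r f + Σ≤ r g
Σ≤-+ zero f g = refl
Σ≤-+ (suc r) f g = trans (cong (_+ (f (suc r) + g (suc r))) (Σ≤-+ r f g))
  (solve 4 (λ a b c d → (a :+ b) :+ (c :+ d) := (a :+ c) :+ (b :+ d)) refl
     (Σ≤ r f) (Σ≤ r g) (f (suc r)) (g (suc r)))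
  where open ℚ-Solver

Σ≤-*ˡ : ∀ r (c : ℚ) (f : ℕ → ℚ) → Σ≤ r (λ j → c * f j) ≡ c * Σ≤ r f
Σ≤-*ˡ zero c f = refl
Σ≤-*ˡ (suc r) c f = trans (cong (_+ (c * f (suc r))) (Σ≤-*ˡ r c f))
                          (sym (QP.*-distribˡ-+ c (Σ≤ r f) (f (suc r))))

Σ≤-drop-last : ∀ r (f : ℕ → ℚ) → f (suc r) ≡ 0ℚ → Σ≤ (suc r) f ≡ Σ≤ r f
Σ≤-drop-last r f last≡0 = trans (cong (λ t → Σ≤ r f + t) last≡0) (QP.+-identityʳ (Σ≤ r f))

alternating-partial-sum : ∀ n r → Σ≤ r (λ j → sgn j * ℕ→ℚ (suc n C j)) ≡ sgn r * ℕ→ℚ (n C r)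
alternating-partial-sum n zero = refl
alternating-partial-sum n (suc r) = begin
  Σ≤ r (λ j → sgn j * ℕ→ℚ (suc n C j)) + ℚ.- sgn r * ℕ→ℚ (suc n C suc r)
    ≡⟨ cong₂ (λ u v → u + ℚ.- sgn r * v) (alternating-partial-sum n r)
             (trans (cong ℕ→ℚ (pascal n r)) (ℕ→ℚ-+ (n C r) (n C suc r))) ⟩
  sgn r * ℕ→ℚ (n C r) + ℚ.- sgn r * (ℕ→ℚ (n C r) + ℕ→ℚ (n C suc r))
    ≡⟨ solve 3 (λ s a b → s :* a :+ (:- s) :* (a :+ b) := (:- s) :* b) refl
         (sgn r) (ℕ→ℚ (n C r)) (ℕ→ℚ (n C suc r)) ⟩
  ℚ.- sgn r * ℕ→ℚ (n C suc r)
    ∎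
  where open ℚ-Solver

ℕ→ℚ-nonNeg : ∀ n → ℚ.NonNegative (ℕ→ℚ n)
ℕ→ℚ-nonNeg zero = _
ℕ→ℚ-nonNeg (suc n) = QP.pos⇒nonNeg (ℕ→ℚ (suc n)) {{QP.normalize-pos (suc n) 1}}

poch-pos : ∀ a .{{_ : Positive a}} n → Positive (poch a n)
poch-pos a zero = _
poch-pos a (suc n) =
  QP.pos*pos⇒pos (poch a n) {{poch-pos a n}} (a + ℕ→ℚ n)
    {{QP.pos+nonNeg⇒pos a (ℕ→ℚ n) {{ℕ→ℚ-nonNeg n}}}}

m*poch-pos : ∀ m i .{{_ : NonZero m}} .{{_ : NonZero i}} n →
             Positive (ℕ→ℚ m * poch (ratio i m) n)
m*poch-pos (suc m) (suc i) n =
  QP.pos*pos⇒pos (ℕ→ℚ (suc m)) {{QP.normalize-pos (suc m) 1}} (poch (ratio (suc i) (suc m)) n)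
    {{poch-pos (ratio (suc i) (suc m)) {{QP.normalize-pos (suc i) (suc m)}} n}}

module Recurrences (m i : ℕ) .{{_ : NonZero m}} .{{_ : NonZero i}} where

  L : ℕ → ℚ
  L j = ℕ→ℚ (lin m i j)

  a : ℕ → ℚ
  a j = ((+ 1) / lin m i j) {{lin-nonZero {m} {i} {j}}}

  a*L≡1 : ∀ j → a j * L j ≡ 1ℚ
  a*L≡1 j = trans (QP.*-comm (a j) (L j)) (n*[a/n]≡a (lin m i j) 1 {{lin-nonZero {m} {i} {j}}})

  cancel-L : ∀ j {x y} → L j * x ≡ L j * y → x ≡ y
  cancel-L j = cancel-invertible {a j} {L j} (a*L≡1 j)

  m*[i/m+j]≡L : ∀ j → ℕ→ℚ m * (ratio i m + ℕ→ℚ j) ≡ L j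
  m*[i/m+j]≡L j = begin
    ℕ→ℚ m * (ratio i m + ℕ→ℚ j)        ≡⟨ QP.*-distribˡ-+ (ℕ→ℚ m) (ratio i m) (ℕ→ℚ j) ⟩
    ℕ→ℚ m * ratio i m + ℕ→ℚ m * ℕ→ℚ j  ≡⟨ cong (_+ ℕ→ℚ m * ℕ→ℚ j) (n*[a/n]≡a m i) ⟩
    ℕ→ℚ i + ℕ→ℚ m * ℕ→ℚ j              ≡⟨ QP.+-comm (ℕ→ℚ i) (ℕ→ℚ m * ℕ→ℚ j) ⟩
    ℕ→ℚ m * ℕ→ℚ j + ℕ→ℚ i              ≡⟨ cong (_+ ℕ→ℚ i) (sym (ℕ→ℚ-* m j)) ⟩
    ℕ→ℚ (m Nat.* j) + ℕ→ℚ i            ≡⟨ sym (ℕ→ℚ-+ (m Nat.* j) i) ⟩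
    L j                                ∎

  D : ℕ → ℚ
  D n = ℕ→ℚ m * poch (ratio i m) (suc n)

  c : ℕ → ℚ
  c = coeff m i

  D-nonZero : ∀ n → ℚ.NonZero (D n)
  D-nonZero n = QP.pos⇒nonZero (D n) {{m*poch-pos m i (suc n)}}

  c*D≡n! : ∀ n → c n * D n ≡ ℕ→ℚ (n !)
  c*D≡n! n = begin
    ℕ→ℚ (n !) * 1/ D n * D n    ≡⟨ QP.*-assoc (ℕ→ℚ (n !)) (1/ D n) (D n) ⟩
    ℕ→ℚ (n !) * (1/ D n * D n)  ≡⟨ cong (ℕ→ℚ (n !) *_) (QP.*-inverseˡ (D n)) ⟩
    ℕ→ℚ (n !) * 1ℚ              ≡⟨ QP.*-identityʳ (ℕ→ℚ (n !)) ⟩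
    ℕ→ℚ (n !)                   ∎
    where instance _ = D-nonZero n

  cancel-D : ∀ n {x y} → D n * x ≡ D n * y → x ≡ y
  cancel-D n = cancel-invertible {1/ D n} {D n} (QP.*-inverseˡ (D n))
    where instance _ = D-nonZero n

  K : ℕ → ℚ
  K n = ℕ→ℚ (suc n) * ℕ→ℚ m

  c-zero : c 0 ≡ a 0
  c-zero = cancel-D 0 (begin
    D 0 * c 0          ≡⟨ QP.*-comm (D 0) (c 0) ⟩
    c 0 * D 0          ≡⟨ c*D≡n! 0 ⟩
    1ℚ                 ≡⟨ sym (a*L≡1 0) ⟩
    a 0 * L 0          ≡⟨ cong (a 0 *_) (sym (m*[i/m+j]≡L 0)) ⟩
    a 0 * (ℕ→ℚ m * r)  ≡⟨ solve 3 (λ x y z → x :* (y :* z) := y :* (con 1ℚ :* z) :* x) refl (a 0) (ℕ→ℚ m) r ⟩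
    D 0 * a 0          ∎)
    where
    open ℚ-Solver
    r = ratio i m + ℕ→ℚ 0

  c-step : ∀ n → L (suc n) * c (suc n) ≡ K n * c n
  c-step n = cancel-D (suc n) (begin
    D (suc n) * (L (suc n) * c (suc n))        ≡⟨ solve 3 (λ d l x → d :* (l :* x) := (x :* d) :* l) refl (D (suc n)) (L (suc n)) (c (suc n)) ⟩
    (c (suc n) * D (suc n)) * L (suc n)        ≡⟨ cong (_* L (suc n)) (trans (c*D≡n! (suc n)) (ℕ→ℚ-* (suc n) (n !))) ⟩
    (ℕ→ℚ (suc n) * ℕ→ℚ (n !)) * L (suc n)      ≡⟨ cong₂ (λ u v → ℕ→ℚ (suc n) * u * v) (sym (c*D≡n! n)) (sym (m*[i/m+j]≡L (suc n))) ⟩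
    (ℕ→ℚ (suc n) * (c n * D n)) * (ℕ→ℚ m * t)  ≡⟨ solve 5 (λ s x mm p t → s :* (x :* (mm :* p)) :* (mm :* t) := mm :* (p :* t) :* (s :* mm :* x)) refl (ℕ→ℚ (suc n)) (c n) (ℕ→ℚ m) (poch (ratio i m) (suc n)) t ⟩
    D (suc n) * (K n * c n)                    ∎)
    where
    open ℚ-Solver
    t = ratio i m + ℕ→ℚ (suc n)

  term : ℕ → ℕ → ℕ → ℚ
  term n k j = sgn j * ℕ→ℚ (n C j) * inv-pow m i j k

  Σ-term≡A : ∀ n k → Σ≤ (suc n) (term n k) ≡ A m i n k
  Σ-term≡A n k = Σ≤-drop-last n (term n k) (begin
    sgn (suc n) * ℕ→ℚ (n C suc n) * inv-pow m i (suc n) k  ≡⟨ cong (λ t → sgn (suc n) * ℕ→ℚ t * inv-pow m i (suc n) k) (row-end n) ⟩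
    sgn (suc n) * 0ℚ * inv-pow m i (suc n) k               ≡⟨ cong (_* inv-pow m i (suc n) k) (QP.*-zeroʳ (sgn (suc n))) ⟩
    0ℚ * inv-pow m i (suc n) k                             ≡⟨ QP.*-zeroˡ (inv-pow m i (suc n) k) ⟩
    0ℚ                                                     ∎)

  L-binomial : ∀ n j → L (suc n) * ℕ→ℚ (suc n C j) ≡ L j * ℕ→ℚ (suc n C j) + K n * ℕ→ℚ (n C j)
  L-binomial n j = begin
    L (suc n) * ℕ→ℚ (suc n C j)              ≡⟨ sym (ℕ→ℚ-* (lin m i (suc n)) (suc n C j)) ⟩
    ℕ→ℚ (lin m i (suc n) Nat.* (suc n C j))  ≡⟨ cong ℕ→ℚ (lin-binomial m i n j) ⟩
    ℕ→ℚ (lin m i j Nat.* (suc n C j) Nat.+ (suc n Nat.* m) Nat.* (n C j))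
      ≡⟨ ℕ→ℚ-+ (lin m i j Nat.* (suc n C j)) ((suc n Nat.* m) Nat.* (n C j)) ⟩
    ℕ→ℚ (lin m i j Nat.* (suc n C j)) + ℕ→ℚ ((suc n Nat.* m) Nat.* (n C j))
      ≡⟨ cong₂ _+_ (ℕ→ℚ-* (lin m i j) (suc n C j))
                   (trans (ℕ→ℚ-* (suc n Nat.* m) (n C j)) (cong (_* ℕ→ℚ (n C j)) (ℕ→ℚ-* (suc n) m))) ⟩
    L j * ℕ→ℚ (suc n C j) + K n * ℕ→ℚ (n C j)                ∎

  term-step : ∀ n k j → L (suc n) * term (suc n) (suc k) j ≡ term (suc n) k j + K n * term n (suc k) j
  term-step n k j = begin
    L (suc n) * (s * b′ * (a j * q))      ≡⟨ solve 5 (λ l s b′ x q → l :* (s :* b′ :* (x :* q)) := (s :* x :* q) :* (l :* b′)) refl (L (suc n)) s b′ (a j) q ⟩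
    (s * a j * q) * (L (suc n) * b′)      ≡⟨ cong ((s * a j * q) *_) (L-binomial n j) ⟩
    (s * a j * q) * (L j * b′ + K n * b)  ≡⟨ solve 7 (λ s x q l b′ k b → (s :* x :* q) :* (l :* b′ :+ k :* b) := (x :* l) :* (s :* b′ :* q) :+ k :* (s :* b :* (x :* q))) refl s (a j) q (L j) b′ (K n) b ⟩
    (a j * L j) * (s * b′ * q) + K n * term n (suc k) j
      ≡⟨ cong (λ u → u * (s * b′ * q) + K n * term n (suc k) j) (a*L≡1 j) ⟩
    1ℚ * (s * b′ * q) + K n * term n (suc k) j
      ≡⟨ cong (_+ K n * term n (suc k) j) (QP.*-identityˡ (s * b′ * q)) ⟩
    term (suc n) k j + K n * term n (suc k) j ∎
    where
    open ℚ-Solver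
    s = sgn j
    b′ = ℕ→ℚ (suc n C j)
    b = ℕ→ℚ (n C j)
    q = inv-pow m i j k

  A-step : ∀ n k → L (suc n) * A m i (suc n) (suc k) ≡ A m i (suc n) k + K n * A m i n (suc k)
  A-step n k = begin
    L (suc n) * A m i (suc n) (suc k)                             ≡⟨ sym (Σ≤-*ˡ (suc n) (L (suc n)) (term (suc n) (suc k))) ⟩
    Σ≤ (suc n) (λ j → L (suc n) * term (suc n) (suc k) j)         ≡⟨ Σ≤-cong (suc n) (term-step n k) ⟩
    Σ≤ (suc n) (λ j → term (suc n) k j + K n * term n (suc k) j)  ≡⟨ Σ≤-+ (suc n) (term (suc n) k) (λ j → K n * term n (suc k) j) ⟩
    A m i (suc n) k + Σ≤ (suc n) (λ j → K n * term n (suc k) j)   ≡⟨ cong (λ t → A m i (suc n) k + t) (Σ≤-*ˡ (suc n) (K n) (term n (suc k))) ⟩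
    A m i (suc n) k + K n * Σ≤ (suc n) (term n (suc k))           ≡⟨ cong (λ t → A m i (suc n) k + K n * t) (Σ-term≡A n (suc k)) ⟩
    A m i (suc n) k + K n * A m i n (suc k)                       ∎

  A-at-zero : ∀ k → A m i 0 k ≡ a 0 ^ℚ k
  A-at-zero k = QP.*-identityˡ (inv-pow m i 0 k)

  B-at-zero : ∀ k → B m i 0 k ≡ a 0 ^ℚ k
  B-at-zero zero = refl
  B-at-zero (suc k) = cong (a 0 *_) (B-at-zero k)

  A-vanish : ∀ n → A m i (suc n) 0 ≡ 0ℚ
  A-vanish n = begin
    A m i (suc n) 0                             ≡⟨ Σ≤-cong (suc n) (λ j → QP.*-identityʳ (sgn j * ℕ→ℚ (suc n C j))) ⟩
    Σ≤ (suc n) (λ j → sgn j * ℕ→ℚ (suc n C j))  ≡⟨ alternating-partial-sum n (suc n) ⟩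
    sgn (suc n) * ℕ→ℚ (n C suc n)               ≡⟨ cong (λ t → sgn (suc n) * ℕ→ℚ t) (row-end n) ⟩
    sgn (suc n) * 0ℚ                            ≡⟨ QP.*-zeroʳ (sgn (suc n)) ⟩
    0ℚ                                          ∎

  A-one : ∀ n → A m i n 1 ≡ c n
  A-one zero = trans (A-at-zero 1) (trans (QP.*-identityʳ (a 0)) (sym c-zero))
  A-one (suc n) = cancel-L (suc n) (begin
    L (suc n) * A m i (suc n) 1        ≡⟨ A-step n 0 ⟩
    A m i (suc n) 0 + K n * A m i n 1  ≡⟨ cong₂ (λ u v → u + K n * v) (A-vanish n) (A-one n) ⟩
    0ℚ + K n * c n                     ≡⟨ QP.+-identityˡ (K n * c n) ⟩
    K n * c n                          ≡⟨ sym (c-step n) ⟩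
    L (suc n) * c (suc n)              ∎)

  A-B : ∀ k n → A m i n (suc k) ≡ c n * B m i n k
  A-B zero n = trans (A-one n) (sym (QP.*-identityʳ (c n)))
  A-B (suc k) zero = begin
    A m i 0 (suc (suc k))   ≡⟨ A-at-zero (suc (suc k)) ⟩
    a 0 * (a 0 * a 0 ^ℚ k)  ≡⟨ cong₂ (λ u v → u * (a 0 * v)) (sym c-zero) (sym (B-at-zero k)) ⟩
    c 0 * B m i 0 (suc k)   ∎
  A-B (suc k) (suc n) = cancel-L (suc n) (begin
    L (suc n) * A m i (suc n) (suc (suc k))               ≡⟨ A-step n (suc k) ⟩
    A m i (suc n) (suc k) + K n * A m i n (suc (suc k))   ≡⟨ cong₂ (λ u v → u + K n * v) (A-B k (suc n)) (A-B (suc k) n) ⟩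
    c (suc n) * B′ + K n * (c n * Bn)                     ≡⟨ cong (λ t → c (suc n) * B′ + t) (sym (QP.*-assoc (K n) (c n) Bn)) ⟩
    c (suc n) * B′ + (K n * c n) * Bn                     ≡⟨ cong (λ u → c (suc n) * B′ + u * Bn) (sym (c-step n)) ⟩
    c (suc n) * B′ + (L (suc n) * c (suc n)) * Bn         ≡⟨ cong (_+ (L (suc n) * c (suc n)) * Bn) (sym (QP.*-identityˡ (c (suc n) * B′))) ⟩
    1ℚ * (c (suc n) * B′) + (L (suc n) * c (suc n)) * Bn  ≡⟨ cong (λ u → u * (c (suc n) * B′) + (L (suc n) * c (suc n)) * Bn) (sym (a*L≡1 (suc n))) ⟩
    (a (suc n) * L (suc n)) * (c (suc n) * B′) + (L (suc n) * c (suc n)) * Bn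
      ≡⟨ solve 5 (λ x l c′ b′ b → (x :* l) :* (c′ :* b′) :+ (l :* c′) :* b := l :* (c′ :* (b :+ x :* b′))) refl (a (suc n)) (L (suc n)) (c (suc n)) B′ Bn ⟩
    L (suc n) * (c (suc n) * B m i (suc n) (suc k))            ∎)
    where
    open ℚ-Solver
    B′ = B m i (suc n) k
    Bn = B m i n (suc k)

proposition1 : (m i : ℕ) .{{_ : NonZero m}} .{{_ : NonZero i}} →
    (A m i 0 0 ≡ 1ℚ)
    × ((n : ℕ) → A m i (suc n) 0 ≡ 0ℚ)
    × ((n : ℕ) → A m i n 1 ≡ coeff m i n)
    × ((n k : ℕ) → A m i n (suc k) ≡ coeff m i n * B m i n k)
proposition1 m i = refl , A-vanish , A-one , λ n k → A-B k n
  where open Recurrences m i
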